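{- Viewing the shifted equality function $\mathrm{SEQ}_n$ as a Boolean function on $2n+\log n$ bits, one has $\mathrm{CC}(\mathrm{SEQ}_n)=\mathrm{CC}(\neg\mathrm{SEQ}_n)=\Theta(n)$, $\mathrm{NCC}(\mathrm{SEQ}_n)=\Theta(n)$, and $\mathrm{NCC}(\neg\mathrm{SEQ}_n)\le 1+2\log n=O(\log n)$.
   Context: $\mathrm{SEQ}_n:\{0,1\}^n\times\{0,1\}^n\times[n]\to\{0,1\}$ is defined by $\mathrm{SEQ}_n(x,y,i)=1$ iff $x_j=y_{t_j}$ for all $j\in[n]$, where $t_j\in[n]$, $t_j\equiv j+i-1\pmod n$; the index $i$ is encoded in $\log n$ bits (logarithms base 2). For a Boolean function $f$ on $N$ variables and $A\subseteq[N]$, $f_A$ is the Boolean matrix with rows indexed by assignments to $A$, columns by assignments to the complement, and entry the value of $f$. For a Boolean matrix $M$, $\mathsf{ccm}(M)$ is its deterministic two-party communication complexity and $\mathsf{nccm}(M)$ its nondeterministic communication complexity. $\mathrm{CC}(f)=\max_{1\le k\le N}\min_{|A|=k}\mathsf{ccm}(f_A)$ and $\mathrm{NCC}(f)=\max_{1\le k\le N}\min_{|A|=k}\mathsf{nccm}(f_A)$. -}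

module Defs where

open import Data.Bool using (Bool; true; false; not; _∧_; _xor_; if_then_else_)
open import Data.Nat using (ℕ; zero; suc; _+_; _*_; _^_; _≤_; _<_)
open import Data.Nat.Properties using (m^n≢0)
open import Data.Nat.DivMod using (_%_; m%n<n)
open import Data.Nat using (_⊔_)
open import Data.Fin using (Fin; toℕ; fromℕ<; _↑ˡ_; _↑ʳ_)
open import Data.Fin.Subset using (Subset; _∈_; _∉_; ∣_∣)
open import Data.Fin.Subset.Properties using (_∈?_)
open import Data.List using (List; length; allFin)
open import Data.Bool.ListAction using (all)
open import Data.List.Relation.Unary.All using (All)
open import Data.List.Relation.Unary.Any using (Any)
open import Data.Product using (Σ; _×_; _,_)
open import Relation.Nullary using (¬_; yes; no)
open import Relation.Binary.PropositionalEquality using (_≡_)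

Matrix : Set → Set → Set
Matrix R C = R → C → Bool

-- Deterministic protocol trees: a leaf outputs a bit; at an Alice node
-- Alice sends one bit depending on her row, at a Bob node Bob sends one
-- bit depending on his column (false ↦ left subtree, true ↦ right subtree).
data Protocol (R C : Set) : Set where
  leaf  : Bool → Protocol R C
  alice : (R → Bool) → Protocol R C → Protocol R C → Protocol R C
  bob   : (C → Bool) → Protocol R C → Protocol R C → Protocol R C

depth : {R C : Set} → Protocol R C → ℕ
depth (leaf _)      = 0
depth (alice _ p q) = suc (depth p ⊔ depth q)
depth (bob _ p q)   = suc (depth p ⊔ depth q)

run : {R C : Set} → Protocol R C → R → C → Bool
run (leaf b)      r c = b
run (alice a p q) r c = if a r then run q r c else run p r c
run (bob b p q)   r c = if b c then run q r c else run p r c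

Computes : {R C : Set} → Protocol R C → Matrix R C → Set
Computes P M = ∀ r c → run P r c ≡ M r c

ccm≤ : {R C : Set} → Matrix R C → ℕ → Set
ccm≤ {R} {C} M c = Σ (Protocol R C) λ P → Computes P M × depth P ≤ c

ccm≥ : {R C : Set} → Matrix R C → ℕ → Set
ccm≥ M c = ∀ d → d < c → ¬ ccm≤ M d

Rect : Set → Set → Set
Rect R C = (R → Bool) × (C → Bool)

InRect : {R C : Set} → Rect R C → R → C → Set
InRect (S , T) r c = (S r ≡ true) × (T c ≡ true)

OneRect : {R C : Set} → Matrix R C → Rect R C → Set
OneRect M ρ = ∀ r c → InRect ρ r c → M r c ≡ true

OneCover : {R C : Set} → Matrix R C → List (Rect R C) → Set
OneCover M ρs = All (OneRect M) ρs × (∀ r c → M r c ≡ true → Any (λ ρ → InRect ρ r c) ρs)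

-- nccm(M) = ⌈log₂ C¹(M)⌉ with C¹(M) the minimum number of
-- 1-monochromatic rectangles covering the 1-entries of M.
-- nccm(M) ≤ c  iff  C¹(M) ≤ 2^c.
nccm≤ : {R C : Set} → Matrix R C → ℕ → Set
nccm≤ {R} {C} M c = Σ (List (Rect R C)) λ ρs → OneCover M ρs × length ρs ≤ 2 ^ c

nccm≥ : {R C : Set} → Matrix R C → ℕ → Set
nccm≥ M c = ∀ d → d < c → ¬ nccm≤ M d

BoolFun : ℕ → Set
BoolFun N = (Fin N → Bool) → Bool

Row : {N : ℕ} → Subset N → Set
Row {N} A = (j : Fin N) → j ∈ A → Bool

Col : {N : ℕ} → Subset N → Set
Col {N} A = (j : Fin N) → j ∉ A → Bool

merge : {N : ℕ} (A : Subset N) → Row A → Col A → Fin N → Bool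
merge A r c j with j ∈? A
... | yes p = r j p
... | no  q = c j q

restrictMatrix : {N : ℕ} → BoolFun N → (A : Subset N) → Matrix (Row A) (Col A)
restrictMatrix f A r c = f (merge A r c)

-- CC(f) = max_{1≤k≤N} min_{|A|=k} ccm(f_A), NCC analogously.
-- Since these are max/min of ℕ-valued quantities we express
-- "value ≤ c" and "value ≥ c" by unfolding max and min.

CC≤ : {N : ℕ} → BoolFun N → ℕ → Set
CC≤ {N} f c = ∀ k → 1 ≤ k → k ≤ N →
  Σ (Subset N) λ A → (∣ A ∣ ≡ k) × ccm≤ (restrictMatrix f A) c

CC≥ : {N : ℕ} → BoolFun N → ℕ → Set
CC≥ {N} f c = Σ ℕ λ k → 1 ≤ k × k ≤ N ×
  (∀ (A : Subset N) → ∣ A ∣ ≡ k → ccm≥ (restrictMatrix f A) c)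

NCC≤ : {N : ℕ} → BoolFun N → ℕ → Set
NCC≤ {N} f c = ∀ k → 1 ≤ k → k ≤ N →
  Σ (Subset N) λ A → (∣ A ∣ ≡ k) × nccm≤ (restrictMatrix f A) c

NCC≥ : {N : ℕ} → BoolFun N → ℕ → Set
NCC≥ {N} f c = Σ ℕ λ k → 1 ≤ k × k ≤ N ×
  (∀ (A : Subset N) → ∣ A ∣ ≡ k → nccm≥ (restrictMatrix f A) c)

-- SEQ_n for n = 2^m, as a Boolean function on 2n + log n = 2^m + 2^m + m bits.
-- The index bits b_0..b_{m-1} encode s = Σ b_k 2^k ∈ {0,…,n-1}, i.e. i = s+1;
-- with 0-based positions, SEQ(x,y,i) = 1 iff x_j = y_{(j+s) mod n} for all j.

bitsValue : (m : ℕ) → (Fin m → Bool) → ℕ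
bitsValue zero    b = 0
bitsValue (suc m) b = (if b Fin.zero then 1 else 0) + 2 * bitsValue m (λ k → b (Fin.suc k))

shiftIndex : (m : ℕ) → Fin (2 ^ m) → ℕ → Fin (2 ^ m)
shiftIndex m j s = fromℕ< (m%n<n (toℕ j + s) (2 ^ m) {{m^n≢0 2 m}})

SEQ : (m : ℕ) → BoolFun (2 ^ m + 2 ^ m + m)
SEQ m α = all (λ j → not (x j xor y (shiftIndex m j s))) (allFin n)
  where
  n = 2 ^ m
  x : Fin n → Bool
  x j = α ((j ↑ˡ n) ↑ˡ m)
  y : Fin n → Bool
  y j = α ((n ↑ʳ j) ↑ˡ m)
  s : ℕ
  s = bitsValue m (λ k → α ((n + n) ↑ʳ k))

¬SEQ : (m : ℕ) → BoolFun (2 ^ m + 2 ^ m + m)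
¬SEQ m α = not (SEQ m α)

-- Θ(n) for a quantity Q(n), n = 2^m, given "Q ≤ c" (Le) and "Q ≥ c" (Ge):
-- there are a constant d ≥ 1 and a threshold m₀ such that for all m ≥ m₀,
-- Q(2^m) ≥ c whenever d·c ≤ 2^m (i.e. Q ≥ ⌊n/d⌋), and Q(2^m) ≤ d·2^m.

ThetaN : (Le Ge : ℕ → ℕ → Set) → Set
ThetaN Le Ge = Σ ℕ λ d → 1 ≤ d × Σ ℕ λ m₀ → ∀ m → m₀ ≤ m →
  (∀ c → d * c ≤ 2 ^ m → Ge m c) × Le m (d * 2 ^ m)

-- Upper bounds: a protocol may simply read all 2n + log n variables, and the accepting leaves of
-- a depth-d protocol are a 1-cover by at most 2^d rectangles, so NCC ≤ CC = O(n); negating the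
-- leaves gives CC(¬SEQ) = CC(SEQ). A rejected input is certified by an index s, a position j and
-- a bit b with x_j = b ≠ y_{j+s}, and each such certificate is a rectangle for every partition:
-- 2n² rectangles.
-- Lower bound: let |A| = n. The log n index bits are few, so A holds a + b ≥ n/2 of the x- and
-- y-variables. Over all n shifts s, the pairs (x_j, y_{j+s}) split between the players number
-- a(n - b) + (n - a)b ≥ n²/16, so some shift splits n/16 pairs. Fixing the index to s and setting
-- x_j = y_{j+s} = w_j, with w ranging over the assignments vanishing off the split pairs, gives a
-- fooling set of size 2^{n/16}: mixing Alice's part of w with Bob's part of w′ ≠ w is rejected.

module Submission where

open import Defs
open import Data.Bool using (Bool; true; false; not; _∧_; _xor_; if_then_else_)
open import Data.Bool.Properties using (not-involutive; if-cong₂; ∧-conicalˡ; ∧-conicalʳ)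
open import Data.Bool.ListAction using (all)
open import Data.Nat using (ℕ; zero; suc; _+_; _*_; _^_; _∸_; _≤_; _<_; z≤n; s≤s; _⊔_; ⌊_/2⌋; NonZero; _≤?_)
open import Data.Nat.DivMod using (_%_; m%n<n; %-distribˡ-+; m%n%n≡m%n; [m+n]%n≡m%n; m<n⇒m%n≡m)
open import Data.Nat.Properties
open import Data.Nat.Tactic.RingSolver using (solve-∀)
open import Data.Fin using (Fin; zero; suc; toℕ; fromℕ<; _↑ˡ_; _↑ʳ_; quotient; remainder; remQuot; combine)
open import Data.Fin.Properties using (toℕ-fromℕ<; toℕ-injective; toℕ<n; 2↔Bool; combine-remQuot; remQuot-combine)
open import Data.Fin.Permutation using (Permutation′; permutation)
import Data.Fin as Fin
import Data.Fin.Properties as Finₚ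
open import Data.Fin.Subset using (Subset; inside; outside; ∣_∣) renaming (⊥ to ⊥ˢ)
open import Data.Fin.Subset.Properties using (∣⊥∣≡0; _∈?_)
open import Data.Vec using (Vec; []; _∷_; tabulate)
import Data.Vec as Vec
open import Data.Vec.Properties using (lookup∘tabulate)
import Data.Vec.Functional as Vector
open import Data.Vec.Functional.Properties using (lookup-++ˡ; lookup-++ʳ)
open import Data.List using (List; []; _∷_; length; map; _++_; lookup; allFin)
import Data.List as List
open import Data.List.Properties using (length-map; length-++; length-tabulate)
open import Data.List.Membership.Propositional using (_∈_)
open import Data.List.Membership.Propositional.Properties using (∈-allFin)
open import Data.List.Relation.Unary.All using (All; []; _∷_)
import Data.List.Relation.Unary.All as All
import Data.List.Relation.Unary.All.Properties as Allₚ
open import Data.List.Relation.Unary.Any using (Any; here; there; index)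
import Data.List.Relation.Unary.Any as Any
import Data.List.Relation.Unary.Any.Properties as Anyₚ
open import Data.Product using (∃-syntax; _×_; _,_; proj₁; proj₂; uncurry)
open import Data.Empty using (⊥)
open import Data.Sum using (inj₁; inj₂)
open import Function using (_∘_; id)
open import Function.Bundles using (Inverse; _⇔_; mk⇔)
open import Relation.Nullary using (does; yes; no; contradiction)
open import Algebra.Properties.Semiring.Sum +-*-semiring
  using (sum; sum-syntax; sum-cong-≗; sum-permute; ∑-comm; ∑-distrib-+; *-distribʳ-sum)
open import Relation.Binary.PropositionalEquality

∧-true⁻ : ∀ {a b} → a ∧ b ≡ true → a ≡ true × b ≡ true
∧-true⁻ {a} {b} a∧b≡true = ∧-conicalˡ a b a∧b≡true , ∧-conicalʳ a b a∧b≡true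

∧-true⁺ : ∀ {a b} → a ≡ true → b ≡ true → a ∧ b ≡ true
∧-true⁺ refl refl = refl

not-true⁻ : ∀ {a} → not a ≡ true → a ≡ false
not-true⁻ {false} _ = refl

not-false⁺ : ∀ {a} → a ≡ false → not a ≡ true
not-false⁺ refl = refl

xnor-refl : ∀ a → not (a xor a) ≡ true
xnor-refl false = refl
xnor-refl true  = refl

xnor-true⁻ : ∀ {a b} → not (a xor b) ≡ true → a ≡ b
xnor-true⁻ {false} {false} _ = refl
xnor-true⁻ {true}  {true}  _ = refl

xnor-false⁻ : ∀ {a b} → not (a xor b) ≡ false → b ≡ not a
xnor-false⁻ {false} {true}  _ = refl
xnor-false⁻ {true}  {false} _ = refl

xnor-not : ∀ a → not (a xor not a) ≡ false
xnor-not false = refl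
xnor-not true  = refl

if-same : ∀ {A : Set} b {x : A} → (if b then x else x) ≡ x
if-same false = refl
if-same true  = refl

if-mismatch : ∀ x y {u v} → x xor y ≡ true → v ≡ not u →
              (if y then u else v) ≡ not (if x then u else v)
if-mismatch false true  _ refl = sym (not-involutive _)
if-mismatch true  false _ refl = refl

toBool : Fin 2 → Bool
toBool = Inverse.to 2↔Bool

toBool-≢ : ∀ {a b} → a ≢ b → toBool b ≡ not (toBool a)
toBool-≢ {zero}     {zero}     a≢b = contradiction refl a≢b
toBool-≢ {zero}     {suc zero} _   = refl
toBool-≢ {suc zero} {zero}     _   = refl
toBool-≢ {suc zero} {suc zero} a≢b = contradiction refl a≢b

digit : Bool → ℕ
digit b = if b then 1 else 0

module _ {A : Set} {f : A → Bool} where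

  all-true⁺ : ∀ xs → (∀ x → f x ≡ true) → all f xs ≡ true
  all-true⁺ []       _     = refl
  all-true⁺ (x ∷ xs) true⁺ rewrite true⁺ x = all-true⁺ xs true⁺

  all-false⁺ : ∀ {x xs} → x ∈ xs → f x ≡ false → all f xs ≡ false
  all-false⁺ (here refl) fx≡false rewrite fx≡false = refl
  all-false⁺ {xs = y ∷ _} (there x∈xs) fx≡false with f y
  ... | false = refl
  ... | true  = all-false⁺ x∈xs fx≡false

  all-false⁻ : ∀ xs → all f xs ≡ false → ∃[ x ] f x ≡ false
  all-false⁻ (x ∷ xs) all≡false with f x in fx
  ... | false = x , fx
  ... | true  = all-false⁻ xs all≡false

all-cong : {A : Set} {f g : A → Bool} → f ≗ g → ∀ xs → all f xs ≡ all g xs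
all-cong f≗g []       = refl
all-cong f≗g (x ∷ xs) = cong₂ _∧_ (f≗g x) (all-cong f≗g xs)

module _ {R C : Set} where

  negate : Protocol R C → Protocol R C
  negate (leaf b)      = leaf (not b)
  negate (alice a p q) = alice a (negate p) (negate q)
  negate (bob b p q)   = bob b (negate p) (negate q)

  run-negate : (P : Protocol R C) → ∀ r c → run (negate P) r c ≡ not (run P r c)
  run-negate (leaf b)      r c = refl
  run-negate (alice a p q) r c with a r
  ... | true  = run-negate q r c
  ... | false = run-negate p r c
  run-negate (bob b p q)   r c with b c
  ... | true  = run-negate q r c
  ... | false = run-negate p r c

  depth-negate : (P : Protocol R C) → depth (negate P) ≡ depth P
  depth-negate (leaf b)      = refl
  depth-negate (alice a p q) = cong suc (cong₂ _⊔_ (depth-negate p) (depth-negate q))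
  depth-negate (bob b p q)   = cong suc (cong₂ _⊔_ (depth-negate p) (depth-negate q))

  ccm≤-cong : {M M′ : Matrix R C} → (∀ r c → M r c ≡ M′ r c) → ∀ {d} → ccm≤ M d → ccm≤ M′ d
  ccm≤-cong M≡M′ (P , computes , depth≤) = P , (λ r c → trans (computes r c) (M≡M′ r c)) , depth≤

  ccm≤-not : {M : Matrix R C} → ∀ {d} → ccm≤ M d → ccm≤ (λ r c → not (M r c)) d
  ccm≤-not (P , computes , depth≤) =
    negate P ,
    (λ r c → trans (run-negate P r c) (cong not (computes r c))) ,
    subst (_≤ _) (sym (depth-negate P)) depth≤

ccm≥-not : {R C : Set} {M : Matrix R C} → ∀ {c} → ccm≥ M c → ccm≥ (λ r c → not (M r c)) c
ccm≥-not {M = M} lower d d<c = lower d d<c ∘ ccm≤-cong (λ r c → not-involutive (M r c)) ∘ ccm≤-not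

+-≤-2^suc-⊔ : ∀ {x y} a b → x ≤ 2 ^ a → y ≤ 2 ^ b → x + y ≤ 2 ^ suc (a ⊔ b)
+-≤-2^suc-⊔ {x} {y} a b x≤ y≤ = begin
  x + y                      ≤⟨ +-mono-≤ (≤-trans x≤ (^-monoʳ-≤ 2 (m≤m⊔n a b)))
                                        (≤-trans y≤ (^-monoʳ-≤ 2 (m≤n⊔m a b))) ⟩
  2 ^ (a ⊔ b) + 2 ^ (a ⊔ b)  ≡⟨ cong (2 ^ (a ⊔ b) +_) (sym (+-identityʳ _)) ⟩
  2 ^ suc (a ⊔ b)            ∎
  where open ≤-Reasoning

length-map-++-map : {A B : Set} (f g : A → B) (xs ys : List A) →
                    length (map f xs ++ map g ys) ≡ length xs + length ys
length-map-++-map f g xs ys = trans (length-++ (map f xs)) (cong₂ _+_ (length-map f xs) (length-map g ys))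

module _ {R C : Set} where

  restrictRows : (R → Bool) → Rect R C → Rect R C
  restrictRows a (S , T) = (λ r → a r ∧ S r) , T

  restrictCols : (C → Bool) → Rect R C → Rect R C
  restrictCols b (S , T) = S , (λ c → b c ∧ T c)

  InRect-restrictRows⁻ : ∀ a ρ {r c} → InRect (restrictRows a ρ) r c → a r ≡ true × InRect ρ r c
  InRect-restrictRows⁻ a ρ (inS , inT) = let (ar , Sr) = ∧-true⁻ inS in ar , Sr , inT

  InRect-restrictCols⁻ : ∀ b ρ {r c} → InRect (restrictCols b ρ) r c → b c ≡ true × InRect ρ r c
  InRect-restrictCols⁻ b ρ (inS , inT) = let (bc , Tc) = ∧-true⁻ inT in bc , inS , Tc

  InRect-restrictRows⁺ : ∀ a ρ {r c} → a r ≡ true → InRect ρ r c → InRect (restrictRows a ρ) r c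
  InRect-restrictRows⁺ a ρ ar (inS , inT) = ∧-true⁺ ar inS , inT

  InRect-restrictCols⁺ : ∀ b ρ {r c} → b c ≡ true → InRect ρ r c → InRect (restrictCols b ρ) r c
  InRect-restrictCols⁺ b ρ bc (inS , inT) = inS , ∧-true⁺ bc inT

  acceptingRects : Protocol R C → List (Rect R C)
  acceptingRects (leaf false)  = []
  acceptingRects (leaf true)   = ((λ _ → true) , (λ _ → true)) ∷ []
  acceptingRects (alice a p q) =
    map (restrictRows (not ∘ a)) (acceptingRects p) ++ map (restrictRows a) (acceptingRects q)
  acceptingRects (bob b p q)   =
    map (restrictCols (not ∘ b)) (acceptingRects p) ++ map (restrictCols b) (acceptingRects q)

  length-acceptingRects : (P : Protocol R C) → length (acceptingRects P) ≤ 2 ^ depth P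
  length-acceptingRects (leaf false)  = z≤n
  length-acceptingRects (leaf true)   = s≤s z≤n
  length-acceptingRects (alice a p q) =
    subst (_≤ _) (sym (length-map-++-map _ _ (acceptingRects p) (acceptingRects q)))
      (+-≤-2^suc-⊔ (depth p) (depth q) (length-acceptingRects p) (length-acceptingRects q))
  length-acceptingRects (bob b p q)   =
    subst (_≤ _) (sym (length-map-++-map _ _ (acceptingRects p) (acceptingRects q)))
      (+-≤-2^suc-⊔ (depth p) (depth q) (length-acceptingRects p) (length-acceptingRects q))

  acceptingRects-one : (P : Protocol R C) → All (OneRect (run P)) (acceptingRects P)
  acceptingRects-one (leaf false)  = []
  acceptingRects-one (leaf true)   = (λ _ _ _ → refl) ∷ []
  acceptingRects-one (alice a p q) =
    Allₚ.++⁺ (Allₚ.map⁺ (All.map onFalse (acceptingRects-one p)))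
             (Allₚ.map⁺ (All.map onTrue (acceptingRects-one q)))
    where
    onFalse : ∀ {ρ} → OneRect (run p) ρ → OneRect (run (alice a p q)) (restrictRows (not ∘ a) ρ)
    onFalse {ρ} one r c inρ with InRect-restrictRows⁻ (not ∘ a) ρ inρ
    ... | ar , inρ′ rewrite not-true⁻ ar = one r c inρ′
    onTrue : ∀ {ρ} → OneRect (run q) ρ → OneRect (run (alice a p q)) (restrictRows a ρ)
    onTrue {ρ} one r c inρ with InRect-restrictRows⁻ a ρ inρ
    ... | ar , inρ′ rewrite ar = one r c inρ′
  acceptingRects-one (bob b p q)   =
    Allₚ.++⁺ (Allₚ.map⁺ (All.map onFalse (acceptingRects-one p)))
             (Allₚ.map⁺ (All.map onTrue (acceptingRects-one q)))
    where
    onFalse : ∀ {ρ} → OneRect (run p) ρ → OneRect (run (bob b p q)) (restrictCols (not ∘ b) ρ)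
    onFalse {ρ} one r c inρ with InRect-restrictCols⁻ (not ∘ b) ρ inρ
    ... | bc , inρ′ rewrite not-true⁻ bc = one r c inρ′
    onTrue : ∀ {ρ} → OneRect (run q) ρ → OneRect (run (bob b p q)) (restrictCols b ρ)
    onTrue {ρ} one r c inρ with InRect-restrictCols⁻ b ρ inρ
    ... | bc , inρ′ rewrite bc = one r c inρ′

  acceptingRects-cover : (P : Protocol R C) → ∀ r c → run P r c ≡ true →
                         Any (λ ρ → InRect ρ r c) (acceptingRects P)
  acceptingRects-cover (leaf true)   r c _ = here (refl , refl)
  acceptingRects-cover (alice a p q) r c accepts with a r in ar
  ... | false = Anyₚ.++⁺ˡ (Anyₚ.map⁺ (Any.map (λ {ρ} → InRect-restrictRows⁺ (not ∘ a) ρ (not-false⁺ ar))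
                                                (acceptingRects-cover p r c accepts)))
  ... | true  = Anyₚ.++⁺ʳ _ (Anyₚ.map⁺ (Any.map (λ {ρ} → InRect-restrictRows⁺ a ρ ar)
                                                  (acceptingRects-cover q r c accepts)))
  acceptingRects-cover (bob b p q)   r c accepts with b c in bc
  ... | false = Anyₚ.++⁺ˡ (Anyₚ.map⁺ (Any.map (λ {ρ} → InRect-restrictCols⁺ (not ∘ b) ρ (not-false⁺ bc))
                                                (acceptingRects-cover p r c accepts)))
  ... | true  = Anyₚ.++⁺ʳ _ (Anyₚ.map⁺ (Any.map (λ {ρ} → InRect-restrictCols⁺ b ρ bc)
                                                  (acceptingRects-cover q r c accepts)))

  ccm≤⇒nccm≤ : {M : Matrix R C} → ∀ {d} → ccm≤ M d → nccm≤ M d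
  ccm≤⇒nccm≤ (P , computes , depth≤) =
    acceptingRects P ,
    (All.map (λ one r c inρ → trans (sym (computes r c)) (one r c inρ)) (acceptingRects-one P) ,
     λ r c accepts → acceptingRects-cover P r c (trans (computes r c) accepts)) ,
    ≤-trans (length-acceptingRects P) (^-monoʳ-≤ 2 depth≤)

  nccm≥⇒ccm≥ : {M : Matrix R C} → ∀ {c} → nccm≥ M c → ccm≥ M c
  nccm≥⇒ccm≥ nc d d<c = nc d d<c ∘ ccm≤⇒nccm≤

  -- One-sided fooling sets: only the entries above the diagonal have to vanish.
  record FoolingSet (M : Matrix R C) (k : ℕ) : Set where
    field
      row          : Fin k → R
      col          : Fin k → C
      diagonal     : ∀ i → M (row i) (col i) ≡ true
      off-diagonal : ∀ {i j} → i Fin.< j → M (row i) (col j) ≡ false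

  -- Two elements of a fooling set in a common rectangle would put an off-diagonal entry in it.
  FoolingSet-≤-cover : {M : Matrix R C} {k : ℕ} {ρs : List (Rect R C)} →
                       FoolingSet M k → OneCover M ρs → k ≤ length ρs
  FoolingSet-≤-cover {M} {k} {ρs} F (ones , covers) = ≮⇒≥ (noCollision ∘ collision)
    where
    open FoolingSet F
    covering : ∀ i → Any (λ ρ → InRect ρ (row i) (col i)) ρs
    covering i = covers (row i) (col i) (diagonal i)
    collision : length ρs < k → ∃[ i ] ∃[ j ] i Fin.< j × index (covering i) ≡ index (covering j)
    collision length<k = Finₚ.pigeonhole length<k (index ∘ covering)
    noCollision : ∃[ i ] ∃[ j ] i Fin.< j × index (covering i) ≡ index (covering j) → ⊥
    noCollision (i , j , i<j , same) =
      contradiction (trans (sym (one (row i) (col j) (proj₁ inᵢ , proj₂ inⱼ))) (off-diagonal i<j)) λ ()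
      where
      ρ = Any.lookup (covering i)
      one : OneRect M ρ
      one = proj₁ (All.lookupAny ones (covering i))
      inᵢ : InRect ρ (row i) (col i)
      inᵢ = Anyₚ.lookup-result (covering i)
      inⱼ : InRect ρ (row j) (col j)
      inⱼ = subst (λ ρ′ → InRect ρ′ (row j) (col j)) (cong (lookup ρs) (sym same))
                  (Anyₚ.lookup-result (covering j))

  FoolingSet-nccm≥ : {M : Matrix R C} {k c : ℕ} → FoolingSet M k → 2 ^ c ≤ k → nccm≥ M c
  FoolingSet-nccm≥ F 2^c≤k d d<c (ρs , cover , length≤) =
    <⇒≱ (^-monoʳ-< 2 (s≤s (s≤s z≤n)) d<c) (≤-trans 2^c≤k (≤-trans (FoolingSet-≤-cover F cover) length≤))

nccm≤-tabulate : {R C : Set} {M : Matrix R C} {K d : ℕ} (ρ : Fin K → Rect R C) →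
                 (∀ i → OneRect M (ρ i)) → (∀ r c → M r c ≡ true → ∃[ i ] InRect (ρ i) r c) →
                 K ≤ 2 ^ d → nccm≤ M d
nccm≤-tabulate ρ ones covers K≤ =
  List.tabulate ρ ,
  (Allₚ.tabulate⁺ ones , λ r c accepts → let (i , inρ) = covers r c accepts in Anyₚ.tabulate⁺ i inρ) ,
  subst (_≤ _) (sym (length-tabulate ρ)) K≤

subsetOfSize : ∀ {N} → ℕ → Subset N
subsetOfSize {zero}  k       = []
subsetOfSize {suc N} zero    = ⊥ˢ
subsetOfSize {suc N} (suc k) = inside ∷ subsetOfSize k

∣subsetOfSize∣ : ∀ {N k} → k ≤ N → ∣ subsetOfSize {N} k ∣ ≡ k
∣subsetOfSize∣ {zero}  z≤n       = refl
∣subsetOfSize∣ {suc N} z≤n       = ∣⊥∣≡0 (suc N)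
∣subsetOfSize∣ {suc N} (s≤s k≤N) = cong suc (∣subsetOfSize∣ k≤N)

module _ {N : ℕ} where

  CC≤-mono : {f : BoolFun N} → ∀ {c c′} → c ≤ c′ → CC≤ f c → CC≤ f c′
  CC≤-mono c≤c′ upper k 1≤k k≤N =
    let (A , size , P , computes , depth≤) = upper k 1≤k k≤N
    in A , size , P , computes , ≤-trans depth≤ c≤c′

  CC≤-not : {f : BoolFun N} → ∀ {c} → CC≤ f c → CC≤ (λ α → not (f α)) c
  CC≤-not upper k 1≤k k≤N =
    let (A , size , protocol) = upper k 1≤k k≤N in A , size , ccm≤-not protocol

  CC≤-not⁻ : {f : BoolFun N} → ∀ {c} → CC≤ (λ α → not (f α)) c → CC≤ f c
  CC≤-not⁻ {f} upper k 1≤k k≤N =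
    let (A , size , protocol) = upper k 1≤k k≤N
    in A , size , ccm≤-cong (λ r c → not-involutive (f (merge A r c))) (ccm≤-not protocol)

  CC≥-not : {f : BoolFun N} → ∀ {c} → CC≥ f c → CC≥ (λ α → not (f α)) c
  CC≥-not (k , 1≤k , k≤N , lower) = k , 1≤k , k≤N , λ A size → ccm≥-not (lower A size)

  CC≤⇒NCC≤ : {f : BoolFun N} → ∀ {c} → CC≤ f c → NCC≤ f c
  CC≤⇒NCC≤ upper k 1≤k k≤N =
    let (A , size , protocol) = upper k 1≤k k≤N in A , size , ccm≤⇒nccm≤ protocol

  NCC≥⇒CC≥ : {f : BoolFun N} → ∀ {c} → NCC≥ f c → CC≥ f c
  NCC≥⇒CC≥ (k , 1≤k , k≤N , lower) = k , 1≤k , k≤N , λ A size → nccm≥⇒ccm≥ (lower A size)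

module _ {N : ℕ} (A : Subset N) where

  restrictRow : (Fin N → Bool) → Row A
  restrictRow α j _ = α j

  restrictCol : (Fin N → Bool) → Col A
  restrictCol α j _ = α j

  merge-restrict : ∀ α β j → merge A (restrictRow α) (restrictCol β) j ≡ (if does (j ∈? A) then α j else β j)
  merge-restrict α β j with j ∈? A
  ... | yes _ = refl
  ... | no  _ = refl

  query : Fin N → (p q : Protocol (Row A) (Col A)) → Protocol (Row A) (Col A)
  query j p q with j ∈? A
  ... | yes j∈A = alice (λ r → r j j∈A) p q
  ... | no  j∉A = bob   (λ c → c j j∉A) p q

  run-query : ∀ j p q r c → run (query j p q) r c ≡ (if merge A r c j then run q r c else run p r c)
  run-query j p q r c with j ∈? A
  ... | yes _ = refl
  ... | no  _ = refl

  depth-query : ∀ j p q → depth (query j p q) ≡ suc (depth p ⊔ depth q)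
  depth-query j p q with j ∈? A
  ... | yes _ = refl
  ... | no  _ = refl

  readVariables : (k : ℕ) → (Fin k → Fin N) → (Vec Bool k → Bool) → Protocol (Row A) (Col A)
  readVariables zero    pos g = leaf (g [])
  readVariables (suc k) pos g =
    query (pos zero) (readVariables k (pos ∘ suc) (g ∘ (false ∷_))) (readVariables k (pos ∘ suc) (g ∘ (true ∷_)))

  run-readVariables : ∀ k pos g r c → run (readVariables k pos g) r c ≡ g (tabulate (merge A r c ∘ pos))
  run-readVariables zero    pos g r c = refl
  run-readVariables (suc k) pos g r c
    rewrite run-query (pos zero) (readVariables k (pos ∘ suc) (g ∘ (false ∷_)))
                                 (readVariables k (pos ∘ suc) (g ∘ (true ∷_))) r c
    with merge A r c (pos zero)
  ... | false = run-readVariables k (pos ∘ suc) (g ∘ (false ∷_)) r c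
  ... | true  = run-readVariables k (pos ∘ suc) (g ∘ (true ∷_)) r c

  depth-readVariables : ∀ k pos g → depth (readVariables k pos g) ≡ k
  depth-readVariables zero    pos g = refl
  depth-readVariables (suc k) pos g = begin
    depth (query (pos zero) (readVariables k (pos ∘ suc) _) (readVariables k (pos ∘ suc) _))
      ≡⟨ depth-query (pos zero) _ _ ⟩
    suc (depth (readVariables k (pos ∘ suc) _) ⊔ depth (readVariables k (pos ∘ suc) _))
      ≡⟨ cong suc (cong₂ _⊔_ (depth-readVariables k _ _) (depth-readVariables k _ _)) ⟩
    suc (k ⊔ k)
      ≡⟨ cong suc (⊔-idem k) ⟩
    suc k ∎
    where open ≡-Reasoning

Extensional : ∀ {N} → BoolFun N → Set
Extensional f = ∀ {α β} → α ≗ β → f α ≡ f β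

ccm≤-extensional : ∀ {N} {f : BoolFun N} → Extensional f → (A : Subset N) → ccm≤ (restrictMatrix f A) N
ccm≤-extensional {N} {f} ext A =
  readVariables A N id (f ∘ Vec.lookup) ,
  (λ r c → trans (run-readVariables A N id _ r c) (ext (lookup∘tabulate (merge A r c)))) ,
  ≤-reflexive (depth-readVariables A N id _)

CC≤-extensional : ∀ {N} {f : BoolFun N} → Extensional f → CC≤ f N
CC≤-extensional ext k 1≤k k≤N = subsetOfSize k , ∣subsetOfSize∣ k≤N , ccm≤-extensional ext (subsetOfSize k)

Literal : ℕ → Set
Literal N = Fin N × Bool

Satisfies : ∀ {N} → (Fin N → Bool) → List (Literal N) → Set
Satisfies α = All (λ (j , b) → α j ≡ b)

module _ {N : ℕ} (A : Subset N) where

  rowAgrees : Row A → Literal N → Bool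
  rowAgrees r (j , b) with j ∈? A
  ... | yes j∈A = not (r j j∈A xor b)
  ... | no  _   = true

  colAgrees : Col A → Literal N → Bool
  colAgrees c (j , b) with j ∈? A
  ... | yes _   = true
  ... | no  j∉A = not (c j j∉A xor b)

  termRect : List (Literal N) → Rect (Row A) (Col A)
  termRect t = (λ r → all (rowAgrees r) t) , (λ c → all (colAgrees c) t)

  InRect-termRect⁻ : ∀ t {r c} → InRect (termRect t) r c → Satisfies (merge A r c) t
  InRect-termRect⁻ []            _          = []
  InRect-termRect⁻ ((j , b) ∷ t) (inS , inT) =
    let (agreeᵣ , inSₜ) = ∧-true⁻ inS ; (agreeₜ , inTₜ) = ∧-true⁻ inT
    in agrees agreeᵣ agreeₜ ∷ InRect-termRect⁻ t (inSₜ , inTₜ)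
    where
    agrees : ∀ {r c} → rowAgrees r (j , b) ≡ true → colAgrees c (j , b) ≡ true → merge A r c j ≡ b
    agrees eᵣ eₜ with j ∈? A
    ... | yes _ = xnor-true⁻ eᵣ
    ... | no  _ = xnor-true⁻ eₜ

  InRect-termRect⁺ : ∀ t {r c} → Satisfies (merge A r c) t → InRect (termRect t) r c
  InRect-termRect⁺ []            _       = refl , refl
  InRect-termRect⁺ ((j , b) ∷ t) (e ∷ es) =
    let (inS , inT) = InRect-termRect⁺ t es ; (agreeᵣ , agreeₜ) = agrees e
    in ∧-true⁺ agreeᵣ inS , ∧-true⁺ agreeₜ inT
    where
    agrees : ∀ {r c} → merge A r c j ≡ b → rowAgrees r (j , b) ≡ true × colAgrees c (j , b) ≡ true
    agrees e with j ∈? A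
    ... | yes _ rewrite e = xnor-refl b , refl
    ... | no  _ rewrite e = refl , xnor-refl b

count : ∀ {k} → (Fin k → Bool) → ℕ
count p = sum (digit ∘ p)

∣∣≡count-∈ : ∀ {N} (A : Subset N) → ∣ A ∣ ≡ count (λ j → does (j ∈? A))
∣∣≡count-∈ []          = refl
∣∣≡count-∈ (true ∷ A)  = cong suc (∣∣≡count-∈ A)
∣∣≡count-∈ (false ∷ A) = ∣∣≡count-∈ A

∣tabulate∣≡count : ∀ {k} (p : Fin k → Bool) → ∣ tabulate p ∣ ≡ count p
∣tabulate∣≡count {zero}  p = refl
∣tabulate∣≡count {suc k} p with p zero
... | true  = cong suc (∣tabulate∣≡count (p ∘ suc))
... | false = ∣tabulate∣≡count (p ∘ suc)

sum-↑ : ∀ a b (f : Fin (a + b) → ℕ) → sum f ≡ sum (f ∘ (_↑ˡ b)) + sum (f ∘ (a ↑ʳ_))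
sum-↑ zero    b f = refl
sum-↑ (suc a) b f = trans (cong (f zero +_) (sum-↑ a b (f ∘ suc))) (sym (+-assoc (f zero) _ _))

count-+-count-not : ∀ {k} (p : Fin k → Bool) → count p + count (not ∘ p) ≡ k
count-+-count-not {zero}  p = refl
count-+-count-not {suc k} p with p zero
... | true  = cong suc (count-+-count-not (p ∘ suc))
... | false = trans (+-suc (count (p ∘ suc)) _) (cong suc (count-+-count-not (p ∘ suc)))

sum-≤ : ∀ {k} (f : Fin k → ℕ) {c} → (∀ i → f i ≤ c) → sum f ≤ k * c
sum-≤ {zero}  f f≤c = z≤n
sum-≤ {suc k} f f≤c = +-mono-≤ (f≤c zero) (sum-≤ (f ∘ suc) (f≤c ∘ suc))

count-≤ : ∀ {k} (p : Fin k → Bool) → count p ≤ k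
count-≤ {k} p = subst (count p ≤_) (*-identityʳ k) (sum-≤ (digit ∘ p) (digit≤1 ∘ p))
  where
  digit≤1 : ∀ b → digit b ≤ 1
  digit≤1 false = z≤n
  digit≤1 true  = s≤s z≤n

averaging : ∀ {k} (f : Fin k → ℕ) {c} → 0 < k → k * c ≤ sum f → ∃[ i ] c ≤ f i
averaging {suc k} f {c} _ k*c≤sum with Finₚ.any? (λ i → c ≤? f i)
... | yes large = large
... | no  ¬large = contradiction k*c≤sum (<⇒≱ sum<)
  where
  small : ∀ i → f i < c
  small i = ≰⇒> (λ c≤fi → ¬large (i , c≤fi))
  sum< : sum f < suc k * c
  sum< = +-mono-<-≤ (small zero) (sum-≤ (f ∘ suc) (<⇒≤ ∘ small ∘ suc))

-- The 2^∣mask∣ words vanishing outside mask, obtained by reading i as binary digits.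
spread : ∀ {k} (mask : Subset k) → Fin (2 ^ ∣ mask ∣) → Fin k → Bool
spread (outside ∷ mask) i zero    = false
spread (outside ∷ mask) i (suc p) = spread mask i p
spread (inside  ∷ mask) i zero    = toBool (quotient (2 ^ ∣ mask ∣) i)
spread (inside  ∷ mask) i (suc p) = spread mask (remainder {2} (2 ^ ∣ mask ∣) i) p

spread-separates : ∀ {k} (mask : Subset k) {i j} → i ≢ j →
                   ∃[ p ] Vec.lookup mask p ≡ true × spread mask j p ≡ not (spread mask i p)
spread-separates []               {zero} {zero} i≢j = contradiction refl i≢j
spread-separates (outside ∷ mask) i≢j =
  let (p , inMask , differ) = spread-separates mask i≢j in suc p , inMask , differ
spread-separates (inside ∷ mask) {i} {j} i≢j
  with quotient {2} (2 ^ ∣ mask ∣) i Finₚ.≟ quotient (2 ^ ∣ mask ∣) j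
     | remainder {2} (2 ^ ∣ mask ∣) i Finₚ.≟ remainder {2} (2 ^ ∣ mask ∣) j
... | no q≢   | _      = zero , refl , toBool-≢ q≢
... | yes _   | no r≢  = let (p , inMask , differ) = spread-separates mask r≢ in suc p , inMask , differ
... | yes q≡  | yes r≡ = contradiction i≡j i≢j
  where
  i≡j : i ≡ j
  i≡j = begin
    i                                           ≡⟨ sym (combine-remQuot {2} (2 ^ ∣ mask ∣) i) ⟩
    uncurry combine (remQuot (2 ^ ∣ mask ∣) i)  ≡⟨ cong₂ combine q≡ r≡ ⟩
    uncurry combine (remQuot (2 ^ ∣ mask ∣) j)  ≡⟨ combine-remQuot {2} (2 ^ ∣ mask ∣) j ⟩
    j                                           ∎
    where open ≡-Reasoning

double : ∀ a → 2 * (a + a) ≡ 4 * a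
double = solve-∀

square≤16*product : ∀ {n a b} → n ≤ 4 * a → a ≤ b → n * n ≤ 16 * (a * b)
square≤16*product {n} {a} {b} n≤4a a≤b = begin
  n * n              ≤⟨ *-mono-≤ n≤4a n≤4a ⟩
  4 * a * (4 * a)    ≡⟨ rearrange a ⟩
  16 * (a * a)       ≤⟨ *-monoʳ-≤ 16 (*-monoʳ-≤ a a≤b) ⟩
  16 * (a * b)       ∎
  where
  open ≤-Reasoning
  rearrange : ∀ a → 4 * a * (4 * a) ≡ 16 * (a * a)
  rearrange = solve-∀

-- If b ≤ a, then n ≤ 4a and a ≤ b̂.
square≤16*dominant : ∀ {n a b b̂} → b + b̂ ≡ n → a + b ≤ n → n ≤ 2 * (a + b) → b ≤ a →
                     n * n ≤ 16 * (a * b̂)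
square≤16*dominant {n} {a} {b} {b̂} b+b̂≡n a+b≤n n≤2[a+b] b≤a = square≤16*product n≤4a a≤b̂
  where
  n≤4a : n ≤ 4 * a
  n≤4a = ≤-trans n≤2[a+b] (≤-trans (*-monoʳ-≤ 2 (+-monoʳ-≤ a b≤a)) (≤-reflexive (double a)))
  a≤b̂ : a ≤ b̂
  a≤b̂ = +-cancelʳ-≤ b a b̂ (≤-trans a+b≤n (≤-reflexive (trans (sym b+b̂≡n) (+-comm b b̂))))

square≤16*crossings : ∀ {n a â b b̂} → a + â ≡ n → b + b̂ ≡ n → a + b ≤ n → n ≤ 2 * (a + b) →
                      n * n ≤ 16 * (a * b̂ + â * b)
square≤16*crossings {n} {a} {â} {b} {b̂} a+â≡n b+b̂≡n a+b≤n n≤2[a+b] with ≤-total b a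
... | inj₁ b≤a = ≤-trans (square≤16*dominant b+b̂≡n a+b≤n n≤2[a+b] b≤a)
                         (*-monoʳ-≤ 16 (m≤m+n (a * b̂) (â * b)))
... | inj₂ a≤b = ≤-trans (square≤16*dominant a+â≡n (≤-trans (≤-reflexive (+-comm b a)) a+b≤n)
                                              (≤-trans n≤2[a+b] (≤-reflexive (cong (2 *_) (+-comm a b)))) a≤b)
                         (*-monoʳ-≤ 16 (≤-trans (≤-reflexive (*-comm b â)) (m≤n+m (â * b) (a * b̂))))

2*m≤2^m : ∀ m → 2 * m ≤ 2 ^ m
2*m≤2^m zero          = z≤n
2*m≤2^m (suc zero)    = s≤s (s≤s z≤n)
2*m≤2^m (suc (suc m)) = begin
  2 * (2 + m)            ≡⟨ *-suc 2 (suc m) ⟩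
  2 + 2 * suc m          ≤⟨ +-mono-≤ (*-monoʳ-≤ 2 (m^n>0 2 m)) (2*m≤2^m (suc m)) ⟩
  2 ^ suc m + 2 ^ suc m  ≡⟨ cong (2 ^ suc m +_) (sym (+-identityʳ _)) ⟩
  2 ^ suc (suc m)        ∎
  where open ≤-Reasoning

n≤2[a+b] : ∀ {n m a b ι} → a + b + ι ≡ n → ι ≤ m → 2 * m ≤ n → n ≤ 2 * (a + b)
n≤2[a+b] {n} {m} {a} {b} {ι} a+b+ι≡n ι≤m 2m≤n = +-cancelʳ-≤ n n (2 * (a + b)) (begin
  n + n                  ≡⟨ cong (n +_) (sym (+-identityʳ n)) ⟩
  2 * n                  ≡⟨ cong (2 *_) (sym a+b+ι≡n) ⟩
  2 * (a + b + ι)        ≡⟨ *-distribˡ-+ 2 (a + b) ι ⟩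
  2 * (a + b) + 2 * ι    ≤⟨ +-monoʳ-≤ (2 * (a + b)) (≤-trans (*-monoʳ-≤ 2 ι≤m) 2m≤n) ⟩
  2 * (a + b) + n        ∎)
  where open ≤-Reasoning

N≤16*2^m : ∀ m → 2 ^ m + 2 ^ m + m ≤ 16 * 2 ^ m
N≤16*2^m m = begin
  2 ^ m + 2 ^ m + m      ≤⟨ +-monoʳ-≤ (2 ^ m + 2 ^ m) (≤-trans (m≤m+n m (m + 0)) (2*m≤2^m m)) ⟩
  2 ^ m + 2 ^ m + 2 ^ m  ≡⟨ triple (2 ^ m) ⟩
  3 * 2 ^ m              ≤⟨ *-monoˡ-≤ (2 ^ m) {3} {16} (s≤s (s≤s (s≤s z≤n))) ⟩
  16 * 2 ^ m             ∎
  where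
  open ≤-Reasoning
  triple : ∀ x → x + x + x ≡ 3 * x
  triple = solve-∀

2^m*[2^m*2]≡2^[1+2m] : ∀ m → 2 ^ m * (2 ^ m * 2) ≡ 2 ^ (1 + 2 * m)
2^m*[2^m*2]≡2^[1+2m] m = begin
  2 ^ m * (2 ^ m * 2)  ≡⟨ rearrange (2 ^ m) ⟩
  2 * (2 ^ m * 2 ^ m)  ≡⟨ cong (2 *_) (sym (^-distribˡ-+-* 2 m m)) ⟩
  2 * 2 ^ (m + m)      ≡⟨ cong (λ e → 2 * 2 ^ (m + e)) (sym (+-identityʳ m)) ⟩
  2 ^ (1 + 2 * m)      ∎
  where
  open ≡-Reasoning
  rearrange : ∀ x → x * (x * 2) ≡ 2 * (x * x)
  rearrange = solve-∀

[m%n+k]%n≡[m+k]%n : ∀ m k n .{{_ : NonZero n}} → (m % n + k) % n ≡ (m + k) % n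
[m%n+k]%n≡[m+k]%n m k n = begin
  (m % n + k) % n          ≡⟨ %-distribˡ-+ (m % n) k n ⟩
  (m % n % n + k % n) % n  ≡⟨ cong (λ x → (x + k % n) % n) (m%n%n≡m%n m n) ⟩
  (m % n + k % n) % n      ≡⟨ sym (%-distribˡ-+ m k n) ⟩
  (m + k) % n              ∎
  where open ≡-Reasoning

lowBit : ℕ → Bool
lowBit zero          = false
lowBit (suc zero)    = true
lowBit (suc (suc s)) = lowBit s

-- Least significant bit first, as in bitsValue.
bitsOf : (m : ℕ) → ℕ → Fin m → Bool
bitsOf (suc m) s zero    = lowBit s
bitsOf (suc m) s (suc k) = bitsOf m ⌊ s /2⌋ k

digit-+2*-suc : ∀ b q → digit b + 2 * suc q ≡ suc (suc (digit b + 2 * q))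
digit-+2*-suc b q = begin
  digit b + 2 * suc q          ≡⟨ cong (digit b +_) (*-suc 2 q) ⟩
  digit b + suc (suc (2 * q))  ≡⟨ +-suc (digit b) (suc (2 * q)) ⟩
  suc (digit b + suc (2 * q))  ≡⟨ cong suc (+-suc (digit b) (2 * q)) ⟩
  suc (suc (digit b + 2 * q))  ∎
  where open ≡-Reasoning

lowBit-digit : ∀ b q → lowBit (digit b + 2 * q) ≡ b
lowBit-digit false zero    = refl
lowBit-digit true  zero    = refl
lowBit-digit b     (suc q) rewrite digit-+2*-suc b q = lowBit-digit b q

⌊digit/2⌋ : ∀ b q → ⌊ digit b + 2 * q /2⌋ ≡ q
⌊digit/2⌋ false zero    = refl
⌊digit/2⌋ true  zero    = refl
⌊digit/2⌋ b     (suc q) rewrite digit-+2*-suc b q = cong suc (⌊digit/2⌋ b q)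

binary-expansion : ∀ s → digit (lowBit s) + 2 * ⌊ s /2⌋ ≡ s
binary-expansion zero          = refl
binary-expansion (suc zero)    = refl
binary-expansion (suc (suc s)) =
  trans (digit-+2*-suc (lowBit s) ⌊ s /2⌋) (cong (2 +_) (binary-expansion s))

bitsValue-bitsOf : ∀ m s → s < 2 ^ m → bitsValue m (bitsOf m s) ≡ s
bitsValue-bitsOf zero    zero    _       = refl
bitsValue-bitsOf zero    (suc s) (s≤s ())
bitsValue-bitsOf (suc m) s       s<2^m+1 = begin
  digit (lowBit s) + 2 * bitsValue m (bitsOf m ⌊ s /2⌋)  ≡⟨ cong (λ v → digit (lowBit s) + 2 * v)
                                                              (bitsValue-bitsOf m ⌊ s /2⌋ half<) ⟩
  digit (lowBit s) + 2 * ⌊ s /2⌋                         ≡⟨ binary-expansion s ⟩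
  s                                                       ∎
  where
  open ≡-Reasoning
  half< : ⌊ s /2⌋ < 2 ^ m
  half< = *-cancelˡ-< 2 ⌊ s /2⌋ (2 ^ m)
            (≤-<-trans (subst (2 * ⌊ s /2⌋ ≤_) (binary-expansion s) (m≤n+m (2 * ⌊ s /2⌋) (digit (lowBit s))))
                       s<2^m+1)

bitsOf-bitsValue : ∀ m (b : Fin m → Bool) → bitsOf m (bitsValue m b) ≗ b
bitsOf-bitsValue (suc m) b zero    = lowBit-digit (b zero) (bitsValue m (b ∘ suc))
bitsOf-bitsValue (suc m) b (suc k) rewrite ⌊digit/2⌋ (b zero) (bitsValue m (b ∘ suc)) =
  bitsOf-bitsValue m (b ∘ suc) k

bitsValue-< : ∀ m (b : Fin m → Bool) → bitsValue m b < 2 ^ m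
bitsValue-< zero    b = s≤s z≤n
bitsValue-< (suc m) b = begin-strict
  digit (b zero) + 2 * v  <⟨ +-monoˡ-< (2 * v) (digit<2 (b zero)) ⟩
  2 + 2 * v               ≡⟨ sym (*-suc 2 v) ⟩
  2 * suc v               ≤⟨ *-monoʳ-≤ 2 (bitsValue-< m (b ∘ suc)) ⟩
  2 * 2 ^ m               ∎
  where
  open ≤-Reasoning
  v = bitsValue m (b ∘ suc)
  digit<2 : ∀ b → digit b < 2
  digit<2 false = s≤s z≤n
  digit<2 true  = s≤s (s≤s z≤n)

bitsValue-cong : ∀ m {b b′ : Fin m → Bool} → b ≗ b′ → bitsValue m b ≡ bitsValue m b′
bitsValue-cong zero    b≗b′ = refl
bitsValue-cong (suc m) b≗b′ =
  cong₂ (λ u v → digit u + 2 * v) (b≗b′ zero) (bitsValue-cong m (b≗b′ ∘ suc))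

module _ (m : ℕ) where

  xPos yPos : Fin (2 ^ m) → Fin (2 ^ m + 2 ^ m + m)
  xPos j = (j ↑ˡ 2 ^ m) ↑ˡ m
  yPos t = (2 ^ m ↑ʳ t) ↑ˡ m

  iPos : Fin m → Fin (2 ^ m + 2 ^ m + m)
  iPos k = (2 ^ m + 2 ^ m) ↑ʳ k

  shiftOf : (Fin (2 ^ m + 2 ^ m + m) → Bool) → ℕ
  shiftOf α = bitsValue m (α ∘ iPos)

  layout : (Fin (2 ^ m) → Bool) → (Fin (2 ^ m) → Bool) → (Fin m → Bool) → Fin (2 ^ m + 2 ^ m + m) → Bool
  layout x y b = (x Vector.++ y) Vector.++ b

  layout-xPos : ∀ x y b j → layout x y b (xPos j) ≡ x j
  layout-xPos x y b j = trans (lookup-++ˡ (x Vector.++ y) b (j ↑ˡ 2 ^ m)) (lookup-++ˡ x y j)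

  layout-yPos : ∀ x y b t → layout x y b (yPos t) ≡ y t
  layout-yPos x y b t = trans (lookup-++ˡ (x Vector.++ y) b (2 ^ m ↑ʳ t)) (lookup-++ʳ x y t)

  layout-iPos : ∀ x y b k → layout x y b (iPos k) ≡ b k
  layout-iPos x y b k = lookup-++ʳ (x Vector.++ y) b k

  SEQ-true : ∀ α → (∀ j → α (yPos (shiftIndex m j (shiftOf α))) ≡ α (xPos j)) → SEQ m α ≡ true
  SEQ-true α matches = all-true⁺ (allFin (2 ^ m)) λ j → subst (λ y → not (α (xPos j) xor y) ≡ true)
                                                              (sym (matches j)) (xnor-refl (α (xPos j)))

  SEQ-false : ∀ α j → α (yPos (shiftIndex m j (shiftOf α))) ≡ not (α (xPos j)) → SEQ m α ≡ false
  SEQ-false α j mismatch = all-false⁺ (∈-allFin j) (subst (λ y → not (α (xPos j) xor y) ≡ false)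
                                                        (sym mismatch) (xnor-not (α (xPos j))))

  SEQ-false⁻ : ∀ α → SEQ m α ≡ false → ∃[ j ] α (yPos (shiftIndex m j (shiftOf α))) ≡ not (α (xPos j))
  SEQ-false⁻ α rejects = let (j , mismatch) = all-false⁻ (allFin (2 ^ m)) rejects in j , xnor-false⁻ mismatch

  SEQ-extensional : Extensional (SEQ m)
  SEQ-extensional {α} {β} α≗β rewrite bitsValue-cong m (α≗β ∘ iPos) =
    all-cong (λ j → cong₂ (λ x y → not (x xor y)) (α≗β (xPos j)) (α≗β (yPos _))) (allFin (2 ^ m))

module _ (m : ℕ) where

  private instance
    2^m≢0 : NonZero (2 ^ m)
    2^m≢0 = m^n≢0 2 m

  toℕ-shiftIndex : ∀ j s → toℕ (shiftIndex m j s) ≡ (toℕ j + s) % 2 ^ m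
  toℕ-shiftIndex j s = toℕ-fromℕ< (m%n<n (toℕ j + s) (2 ^ m))

  shiftIndex-+ : ∀ j s t → shiftIndex m (shiftIndex m j s) t ≡ shiftIndex m j (s + t)
  shiftIndex-+ j s t = toℕ-injective (begin
    toℕ (shiftIndex m (shiftIndex m j s) t)  ≡⟨ toℕ-shiftIndex (shiftIndex m j s) t ⟩
    (toℕ (shiftIndex m j s) + t) % 2 ^ m     ≡⟨ cong (λ x → (x + t) % 2 ^ m) (toℕ-shiftIndex j s) ⟩
    ((toℕ j + s) % 2 ^ m + t) % 2 ^ m        ≡⟨ [m%n+k]%n≡[m+k]%n (toℕ j + s) t (2 ^ m) ⟩
    (toℕ j + s + t) % 2 ^ m                  ≡⟨ cong (_% 2 ^ m) (+-assoc (toℕ j) s t) ⟩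
    (toℕ j + (s + t)) % 2 ^ m                ≡⟨ sym (toℕ-shiftIndex j (s + t)) ⟩
    toℕ (shiftIndex m j (s + t))             ∎)
    where open ≡-Reasoning

  shiftIndex-2^m : ∀ j → shiftIndex m j (2 ^ m) ≡ j
  shiftIndex-2^m j = toℕ-injective (begin
    toℕ (shiftIndex m j (2 ^ m))  ≡⟨ toℕ-shiftIndex j (2 ^ m) ⟩
    (toℕ j + 2 ^ m) % 2 ^ m       ≡⟨ [m+n]%n≡m%n (toℕ j) (2 ^ m) ⟩
    toℕ j % 2 ^ m                 ≡⟨ m<n⇒m%n≡m (toℕ<n j) ⟩
    toℕ j                         ∎)
    where open ≡-Reasoning

  shiftIndex-inverse : ∀ j s t → s + t ≡ 2 ^ m → shiftIndex m (shiftIndex m j s) t ≡ j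
  shiftIndex-inverse j s t s+t≡2^m =
    trans (shiftIndex-+ j s t) (trans (cong (shiftIndex m j) s+t≡2^m) (shiftIndex-2^m j))

  shiftIndex-comm : ∀ j s → shiftIndex m j (toℕ s) ≡ shiftIndex m s (toℕ j)
  shiftIndex-comm j s = toℕ-injective (begin
    toℕ (shiftIndex m j (toℕ s))  ≡⟨ toℕ-shiftIndex j (toℕ s) ⟩
    (toℕ j + toℕ s) % 2 ^ m       ≡⟨ cong (_% 2 ^ m) (+-comm (toℕ j) (toℕ s)) ⟩
    (toℕ s + toℕ j) % 2 ^ m       ≡⟨ sym (toℕ-shiftIndex s (toℕ j)) ⟩
    toℕ (shiftIndex m s (toℕ j))  ∎)
    where open ≡-Reasoning

  rotation : ∀ s → s ≤ 2 ^ m → Permutation′ (2 ^ m)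
  rotation s s≤2^m = permutation (λ j → shiftIndex m j s) (λ j → shiftIndex m j (2 ^ m ∸ s))
    (λ j → shiftIndex-inverse j (2 ^ m ∸ s) s (m∸n+n≡m s≤2^m))
    (λ j → shiftIndex-inverse j s (2 ^ m ∸ s) (m+[n∸m]≡n s≤2^m))

  sum-shiftIndex : ∀ (f : Fin (2 ^ m) → ℕ) j → ∑[ s < 2 ^ m ] f (shiftIndex m j (toℕ s)) ≡ sum f
  sum-shiftIndex f j = begin
    ∑[ s < 2 ^ m ] f (shiftIndex m j (toℕ s))  ≡⟨ sum-cong-≗ (λ s → cong f (shiftIndex-comm j s)) ⟩
    ∑[ s < 2 ^ m ] f (shiftIndex m s (toℕ j))  ≡⟨ sym (sum-permute f (rotation (toℕ j) (<⇒≤ (toℕ<n j)))) ⟩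
    sum f                                       ∎
    where open ≡-Reasoning

module Separation (m : ℕ) (A : Subset (2 ^ m + 2 ^ m + m)) where

  onAlice : Fin (2 ^ m + 2 ^ m + m) → Bool
  onAlice j = does (j ∈? A)

  xAlice yAlice : Fin (2 ^ m) → Bool
  xAlice = onAlice ∘ xPos m
  yAlice = onAlice ∘ yPos m

  separated : ℕ → Fin (2 ^ m) → Bool
  separated s j = xAlice j xor yAlice (shiftIndex m j s)

  ∣A∣≡count : ∣ A ∣ ≡ count xAlice + count yAlice + count (onAlice ∘ iPos m)
  ∣A∣≡count = begin
    ∣ A ∣                                 ≡⟨ ∣∣≡count-∈ A ⟩
    count onAlice                         ≡⟨ sum-↑ (2 ^ m + 2 ^ m) m (digit ∘ onAlice) ⟩
    count (onAlice ∘ (_↑ˡ m)) + count (onAlice ∘ iPos m)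
      ≡⟨ cong (_+ count (onAlice ∘ iPos m)) (sum-↑ (2 ^ m) (2 ^ m) (digit ∘ onAlice ∘ (_↑ˡ m))) ⟩
    count xAlice + count yAlice + count (onAlice ∘ iPos m) ∎
    where open ≡-Reasoning

  sum-separated : ∑[ s < 2 ^ m ] count (separated (toℕ s))
                  ≡ count xAlice * count (not ∘ yAlice) + count (not ∘ xAlice) * count yAlice
  sum-separated = begin
    ∑[ s < 2 ^ m ] ∑[ j < 2 ^ m ] digit (xAlice j xor yAlice (shiftIndex m j (toℕ s)))
      ≡⟨ ∑-comm {2 ^ m} {2 ^ m} (λ s j → digit (xAlice j xor yAlice (shiftIndex m j (toℕ s)))) ⟩
    ∑[ j < 2 ^ m ] ∑[ s < 2 ^ m ] digit (xAlice j xor yAlice (shiftIndex m j (toℕ s)))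
      ≡⟨ sum-cong-≗ (λ j → sum-shiftIndex m (λ t → digit (xAlice j xor yAlice t)) j) ⟩
    ∑[ j < 2 ^ m ] ∑[ t < 2 ^ m ] digit (xAlice j xor yAlice t)
      ≡⟨ sum-cong-≗ (λ j → sum-xor (xAlice j)) ⟩
    ∑[ j < 2 ^ m ] (digit (xAlice j) * b̂ + digit (not (xAlice j)) * b)
      ≡⟨ ∑-distrib-+ (λ j → digit (xAlice j) * b̂) (λ j → digit (not (xAlice j)) * b) ⟩
    ∑[ j < 2 ^ m ] (digit (xAlice j) * b̂) + ∑[ j < 2 ^ m ] (digit (not (xAlice j)) * b)
      ≡⟨ sym (cong₂ _+_ (*-distribʳ-sum b̂ (digit ∘ xAlice)) (*-distribʳ-sum b (digit ∘ not ∘ xAlice))) ⟩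
    count xAlice * b̂ + count (not ∘ xAlice) * b ∎
    where
    open ≡-Reasoning
    b = count yAlice
    b̂ = count (not ∘ yAlice)
    sum-xor : ∀ x → ∑[ t < 2 ^ m ] digit (x xor yAlice t) ≡ digit x * b̂ + digit (not x) * b
    sum-xor true  = sym (trans (+-identityʳ _) (+-identityʳ _))
    sum-xor false = sym (+-identityʳ _)

  many-separated : ∀ {c} → ∣ A ∣ ≡ 2 ^ m → 16 * c ≤ 2 ^ m → ∃[ s ] c ≤ count (separated (toℕ s))
  many-separated {c} ∣A∣≡2^m 16c≤2^m =
    averaging (λ s → count (separated (toℕ s))) (m^n>0 2 m) (*-cancelˡ-≤ 16 (begin
      16 * (n * c)                                    ≡⟨ *-comm-middle 16 n c ⟩
      n * (16 * c)                                    ≤⟨ *-monoʳ-≤ n 16c≤2^m ⟩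
      n * n                                           ≤⟨ n*n≤ ⟩
      16 * (a * count (not ∘ yAlice) + count (not ∘ xAlice) * b) ≡⟨ cong (16 *_) (sym sum-separated) ⟩
      16 * ∑[ s < 2 ^ m ] count (separated (toℕ s))   ∎))
    where
    open ≤-Reasoning
    n = 2 ^ m
    a = count xAlice
    b = count yAlice
    a+b+ι≡n : a + b + count (onAlice ∘ iPos m) ≡ n
    a+b+ι≡n = trans (sym ∣A∣≡count) ∣A∣≡2^m
    n*n≤ : n * n ≤ 16 * (a * count (not ∘ yAlice) + count (not ∘ xAlice) * b)
    n*n≤ = square≤16*crossings {a = a} {count (not ∘ xAlice)} {b} {count (not ∘ yAlice)}
             (count-+-count-not xAlice) (count-+-count-not yAlice)
             (subst (a + b ≤_) a+b+ι≡n (m≤m+n (a + b) _))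
             (n≤2[a+b] {a = a} {b = b} a+b+ι≡n (count-≤ (onAlice ∘ iPos m)) (2*m≤2^m m))
    *-comm-middle : ∀ x y z → x * (y * z) ≡ y * (x * z)
    *-comm-middle = solve-∀

module SEQ-FoolingSet (m : ℕ) (A : Subset (2 ^ m + 2 ^ m + m)) (s : Fin (2 ^ m)) where
  open Separation m A

  mask : Subset (2 ^ m)
  mask = tabulate (separated (toℕ s))

  unshift : Fin (2 ^ m) → Fin (2 ^ m)
  unshift t = shiftIndex m t (2 ^ m ∸ toℕ s)

  -- x = w, y_{j+s} = w_j, and the index encodes the shift s.
  input : Fin (2 ^ ∣ mask ∣) → Fin (2 ^ m + 2 ^ m + m) → Bool
  input i = layout m (spread mask i) (spread mask i ∘ unshift) (bitsOf m (toℕ s))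

  mixed : (i j : Fin (2 ^ ∣ mask ∣)) → Fin (2 ^ m + 2 ^ m + m) → Bool
  mixed i j = merge A (restrictRow A (input i)) (restrictCol A (input j))

  module _ (i j : Fin (2 ^ ∣ mask ∣)) where

    shiftOf-mixed : shiftOf m (mixed i j) ≡ toℕ s
    shiftOf-mixed = trans (bitsValue-cong m bits) (bitsValue-bitsOf m (toℕ s) (toℕ<n s))
      where
      bits : ∀ k → mixed i j (iPos m k) ≡ bitsOf m (toℕ s) k
      bits k = trans (merge-restrict A (input i) (input j) (iPos m k))
        (trans (if-cong₂ (onAlice (iPos m k)) (layout-iPos m _ _ _ k) (layout-iPos m _ _ _ k)) (if-same _))

    mixed-xPos : ∀ q → mixed i j (xPos m q) ≡ (if xAlice q then spread mask i q else spread mask j q)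
    mixed-xPos q = trans (merge-restrict A (input i) (input j) (xPos m q))
      (if-cong₂ (xAlice q) (layout-xPos m _ _ _ q) (layout-xPos m _ _ _ q))

    mixed-yPos : ∀ q → let t = shiftIndex m q (toℕ s) in
                 mixed i j (yPos m t) ≡ (if yAlice t then spread mask i q else spread mask j q)
    mixed-yPos q = trans (merge-restrict A (input i) (input j) (yPos m t))
      (if-cong₂ (yAlice t) (trans (layout-yPos m _ _ _ t) (cong (spread mask i) unshift-t))
                           (trans (layout-yPos m _ _ _ t) (cong (spread mask j) unshift-t)))
      where
      t = shiftIndex m q (toℕ s)
      unshift-t : unshift t ≡ q
      unshift-t = shiftIndex-inverse m q (toℕ s) (2 ^ m ∸ toℕ s) (m+[n∸m]≡n (<⇒≤ (toℕ<n s)))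

  fooling : FoolingSet (restrictMatrix (SEQ m) A) (2 ^ ∣ mask ∣)
  fooling = record
    { row          = restrictRow A ∘ input
    ; col          = restrictCol A ∘ input
    ; diagonal     = λ i → SEQ-true m (mixed i i) λ q → begin
        mixed i i (yPos m (shiftIndex m q (shiftOf m (mixed i i))))
          ≡⟨ cong (λ s′ → mixed i i (yPos m (shiftIndex m q s′))) (shiftOf-mixed i i) ⟩
        mixed i i (yPos m (shiftIndex m q (toℕ s)))  ≡⟨ trans (mixed-yPos i i q) (if-same _) ⟩
        spread mask i q                               ≡⟨ sym (trans (mixed-xPos i i q) (if-same _)) ⟩
        mixed i i (xPos m q)                          ∎
    ; off-diagonal = λ {i} {j} i<j →
        let (q , q∈mask , differ) = spread-separates mask (Finₚ.<⇒≢ i<j) in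
        SEQ-false m (mixed i j) q (begin
          mixed i j (yPos m (shiftIndex m q (shiftOf m (mixed i j))))
            ≡⟨ cong (λ s′ → mixed i j (yPos m (shiftIndex m q s′))) (shiftOf-mixed i j) ⟩
          mixed i j (yPos m (shiftIndex m q (toℕ s)))
            ≡⟨ mixed-yPos i j q ⟩
          (if yAlice (shiftIndex m q (toℕ s)) then spread mask i q else spread mask j q)
            ≡⟨ if-mismatch (xAlice q) _ (trans (sym (lookup∘tabulate _ q)) q∈mask) differ ⟩
          not (if xAlice q then spread mask i q else spread mask j q)
            ≡⟨ cong not (sym (mixed-xPos i j q)) ⟩
          not (mixed i j (xPos m q)) ∎)
    }
    where open ≡-Reasoning

module _ (m : ℕ) where

  mismatchTerm : Fin (2 ^ m) → Fin (2 ^ m) → Bool → List (Literal (2 ^ m + 2 ^ m + m))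
  mismatchTerm s j b =
    (xPos m j , b) ∷ (yPos m (shiftIndex m j (toℕ s)) , not b) ∷
    List.tabulate (λ k → iPos m k , bitsOf m (toℕ s) k)

  SEQ-false-mismatchTerm : ∀ α s j b → Satisfies α (mismatchTerm s j b) → SEQ m α ≡ false
  SEQ-false-mismatchTerm α s j b (x≡b ∷ y≡¬b ∷ index≡s) = SEQ-false m α j (begin
    α (yPos m (shiftIndex m j (shiftOf m α)))  ≡⟨ cong (λ s′ → α (yPos m (shiftIndex m j s′))) shiftOf≡s ⟩
    α (yPos m (shiftIndex m j (toℕ s)))        ≡⟨ y≡¬b ⟩
    not b                                       ≡⟨ cong not (sym x≡b) ⟩
    not (α (xPos m j))                          ∎)
    where
    open ≡-Reasoning
    shiftOf≡s : shiftOf m α ≡ toℕ s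
    shiftOf≡s = trans (bitsValue-cong m (Allₚ.tabulate⁻ index≡s)) (bitsValue-bitsOf m (toℕ s) (toℕ<n s))

  mismatchTerm-complete : ∀ α → SEQ m α ≡ false → ∃[ s ] ∃[ j ] Satisfies α (mismatchTerm s j (α (xPos m j)))
  mismatchTerm-complete α rejects =
    s , j , refl ∷ subst (λ s′ → α (yPos m (shiftIndex m j s′)) ≡ not (α (xPos m j))) (sym toℕ-s) mismatch
          ∷ Allₚ.tabulate⁺ λ k → sym (trans (cong (λ v → bitsOf m v k) toℕ-s)
                                           (bitsOf-bitsValue m (α ∘ iPos m) k))
    where
    s : Fin (2 ^ m)
    s = fromℕ< (bitsValue-< m (α ∘ iPos m))
    toℕ-s : toℕ s ≡ shiftOf m α
    toℕ-s = toℕ-fromℕ< (bitsValue-< m (α ∘ iPos m))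
    j = proj₁ (SEQ-false⁻ m α rejects)
    mismatch = proj₂ (SEQ-false⁻ m α rejects)

  private
    decode : Fin (2 ^ m) → Fin (2 ^ m * 2) → List (Literal (2 ^ m + 2 ^ m + m))
    decode s = uncurry (λ j b → mismatchTerm s j (toBool b)) ∘ remQuot 2

  mismatchTermAt : Fin (2 ^ m * (2 ^ m * 2)) → List (Literal (2 ^ m + 2 ^ m + m))
  mismatchTermAt = uncurry decode ∘ remQuot (2 ^ m * 2)

  mismatchTermAt-combine : ∀ s j b → mismatchTermAt (combine s (combine j b)) ≡ mismatchTerm s j (toBool b)
  mismatchTermAt-combine s j b =
    trans (cong (uncurry decode) (remQuot-combine s (combine j b)))
          (cong (uncurry (λ j b → mismatchTerm s j (toBool b))) (remQuot-combine j b))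

  SEQ-false-mismatchTermAt : ∀ α i → Satisfies α (mismatchTermAt i) → SEQ m α ≡ false
  SEQ-false-mismatchTermAt α i = SEQ-false-mismatchTerm α s j (toBool b)
    where
    s = quotient (2 ^ m * 2) i
    j = quotient 2 (remainder {2 ^ m} (2 ^ m * 2) i)
    b = remainder {2 ^ m} 2 (remainder {2 ^ m} (2 ^ m * 2) i)

  mismatchTermAt-complete : ∀ α → SEQ m α ≡ false → ∃[ i ] Satisfies α (mismatchTermAt i)
  mismatchTermAt-complete α rejects =
    let (s , j , satisfies) = mismatchTerm-complete α rejects
        b = Inverse.from 2↔Bool (α (xPos m j))
    in combine s (combine j b) ,
       subst (Satisfies α) (sym (mismatchTermAt-combine s j b))
         (subst (Satisfies α ∘ mismatchTerm s j) (sym (Inverse.strictlyInverseˡ 2↔Bool _)) satisfies)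

NCC≤-¬SEQ : ∀ m → NCC≤ (¬SEQ m) (1 + 2 * m)
NCC≤-¬SEQ m k 1≤k k≤N =
  A , ∣subsetOfSize∣ k≤N ,
  nccm≤-tabulate {d = 1 + 2 * m} (termRect A ∘ mismatchTermAt m)
    (λ i r c inρ → not-false⁺ (SEQ-false-mismatchTermAt m (merge A r c) i (InRect-termRect⁻ A _ inρ)))
    (λ r c accepts → let (i , satisfies) = mismatchTermAt-complete m (merge A r c) (not-true⁻ accepts)
                     in i , InRect-termRect⁺ A _ satisfies)
    (≤-reflexive (2^m*[2^m*2]≡2^[1+2m] m))
  where
  A = subsetOfSize k

CC≤-SEQ : ∀ m → CC≤ (SEQ m) (16 * 2 ^ m)
CC≤-SEQ m = CC≤-mono {f = SEQ m} (N≤16*2^m m) (CC≤-extensional (SEQ-extensional m))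

NCC≥-SEQ : ∀ m c → 16 * c ≤ 2 ^ m → NCC≥ (SEQ m) c
NCC≥-SEQ m c 16c≤2^m = 2 ^ m , m^n>0 2 m , 2^m≤N , lower
  where
  2^m≤N : 2 ^ m ≤ 2 ^ m + 2 ^ m + m
  2^m≤N = ≤-trans (m≤m+n (2 ^ m) (2 ^ m)) (m≤m+n _ m)
  lower : ∀ A → ∣ A ∣ ≡ 2 ^ m → nccm≥ (restrictMatrix (SEQ m) A) c
  lower A ∣A∣≡2^m =
    let (s , c≤separated) = Separation.many-separated m A ∣A∣≡2^m 16c≤2^m
    in FoolingSet-nccm≥ (SEQ-FoolingSet.fooling m A s)
         (^-monoʳ-≤ 2 (subst (c ≤_) (sym (∣tabulate∣≡count (Separation.separated m A (toℕ s)))) c≤separated))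

CC≥-SEQ : ∀ m c → 16 * c ≤ 2 ^ m → CC≥ (SEQ m) c
CC≥-SEQ m c = NCC≥⇒CC≥ {f = SEQ m} ∘ NCC≥-SEQ m c

proposition3p9 : ((m c : ℕ) → CC≤ (SEQ m) c ⇔ CC≤ (¬SEQ m) c)
    × ThetaN (λ m c → CC≤ (SEQ m) c) (λ m c → CC≥ (SEQ m) c)
    × ThetaN (λ m c → CC≤ (¬SEQ m) c) (λ m c → CC≥ (¬SEQ m) c)
    × ThetaN (λ m c → NCC≤ (SEQ m) c) (λ m c → NCC≥ (SEQ m) c)
    × ((m : ℕ) → NCC≤ (¬SEQ m) (1 + 2 * m))
proposition3p9 =
  (λ m c → mk⇔ (CC≤-not {f = SEQ m}) (CC≤-not⁻ {f = SEQ m})) ,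
  (16 , s≤s z≤n , 0 , λ m _ → CC≥-SEQ m , CC≤-SEQ m) ,
  (16 , s≤s z≤n , 0 , λ m _ → (λ c → CC≥-not {f = SEQ m} ∘ CC≥-SEQ m c) ,
                               CC≤-not {f = SEQ m} (CC≤-SEQ m)) ,
  (16 , s≤s z≤n , 0 , λ m _ → NCC≥-SEQ m , CC≤⇒NCC≤ {f = SEQ m} (CC≤-SEQ m)) ,
  NCC≤-¬SEQ
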